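{- Let $a,b,c$ be positive integers such that $Q^{abc}=1+x^a(x+1)^b(1+x+x^2)^c$ is irreducible over $\mathbb{F}_2$, and suppose $(Q^{abc})^*=Q^{def}\neq Q^{abc}$ for some positive integers $d,e,f$. If $a+b+2c=2^nu$ with $n$ a nonnegative integer and $u$ odd, then $u\equiv 0 \pmod 3$.
   Context: Here $Q=1+x+x^2$, $Q^{def}:=1+x^d(x+1)^eQ^f$, and $P^*(x):=x^{\deg P}P(1/x)$ is the reciprocal of $P\in\mathbb{F}_2[x]$; thus $(Q^{abc})^*=x^{a+b+2c}+(x+1)^b(x^2+x+1)^c$. -}

module Defs where

open import Data.Bool using (Bool; true; false; _xor_; if_then_else_)
open import Data.List using (List; []; _∷_; length; reverse)
open import Data.Nat using (ℕ; zero; suc; _∸_)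
open import Data.Sum using (_⊎_)
open import Relation.Binary.PropositionalEquality using (_≡_)

-- Polynomials over F₂ as coefficient lists, lowest degree first
-- (Bool = F₂, with xor as addition and ∧ as multiplication).
-- Trailing zero coefficients are allowed; equality is coefficientwise.
Poly : Set
Poly = List Bool

coeff : Poly → ℕ → Bool
coeff []      _       = false
coeff (a ∷ p) zero    = a
coeff (a ∷ p) (suc i) = coeff p i

_≈ₚ_ : Poly → Poly → Set
p ≈ₚ q = ∀ i → coeff p i ≡ coeff q i

infixl 6 _+ₚ_
infixl 7 _*ₚ_

_+ₚ_ : Poly → Poly → Poly
[]      +ₚ q       = q
(a ∷ p) +ₚ []      = a ∷ p
(a ∷ p) +ₚ (b ∷ q) = (a xor b) ∷ (p +ₚ q)

_*ₚ_ : Poly → Poly → Poly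
[]      *ₚ q = []
(a ∷ p) *ₚ q = (if a then q else []) +ₚ (false ∷ (p *ₚ q))

_^ₚ_ : Poly → ℕ → Poly
p ^ₚ zero  = true ∷ []
p ^ₚ suc n = p *ₚ (p ^ₚ n)

oneₚ X X+1 Qₚ : Poly
oneₚ = true ∷ []
X    = false ∷ true ∷ []
X+1  = true ∷ true ∷ []
Qₚ   = true ∷ true ∷ true ∷ []

normalize : Poly → Poly
normalize [] = []
normalize (a ∷ p) with normalize p
... | []    = if a then true ∷ [] else []
... | r ∷ rs = a ∷ r ∷ rs

-- degree (the zero polynomial gets degree 0)
deg : Poly → ℕ
deg p = length (normalize p) ∸ 1

-- reciprocal P*(x) = x^{deg P} P(1/x)
reciprocal : Poly → Poly
reciprocal p = reverse (normalize p)

-- irreducible over F₂: nonconstant, and any factorisation has a constant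
-- (necessarily nonzero, hence unit) factor
Irreducible : Poly → Set
Irreducible p = (1 Data.Nat.≤ deg p) × (∀ g h → p ≈ₚ (g *ₚ h) → deg g ≡ 0 ⊎ deg h ≡ 0)
  where open import Data.Product using (_×_)

Qabc : ℕ → ℕ → ℕ → Poly
Qabc a b c = oneₚ +ₚ ((X ^ₚ a) *ₚ ((X+1 ^ₚ b) *ₚ (Qₚ ^ₚ c)))

module Submission where

-- Let ω be a root of Q = 1 + x + x² in 𝔽₄.  Then ω² = ω⁻¹ is the other root
-- and ω³ = 1.  As c ≥ 1, Q divides Q^{abc} - 1, so Q^{abc} takes the value 1
-- at both roots of Q (and likewise Q^{def}).  For P of degree N the
-- reciprocal satisfies P*(z) = z^N · P(z⁻¹); with P = Q^{abc} and
-- N = deg P = a + b + 2c this gives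
--   1 = Q^{def}(ω) = P*(ω) = ω^N · P(ω²) = ω^N,
-- so 3 ∣ N = 2ⁿu, hence 3 ∣ u.

open import Defs
open import Data.Nat using (ℕ; _+_; _*_; _^_; _≤_)
open import Data.Nat.Divisibility using (_∣_)
open import Relation.Binary.PropositionalEquality using (_≡_)
open import Relation.Nullary using (¬_)

open import Data.Bool using (Bool; true; false; _xor_; _∧_; if_then_else_)
open import Data.Bool.Properties using (∧-zeroʳ; xor-identityʳ) renaming (_≟_ to _≟ᵇ_)
open import Data.List using ([]; _∷_; _++_; length; reverse)
open import Data.List.Properties using (unfold-reverse; length-reverse)
open import Data.Nat using (zero; suc; _<_; s≤s; z≤n)
open import Data.Nat.Properties using (≤-refl; ≤-trans; <⇒≤; m≤n+m; m≤n*m; *-identityˡ; *-assoc)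
open import Data.Nat.Divisibility using (∣-refl; _∣0; ∣m∣n⇒∣m+n; _∣?_)
open import Data.Nat.Primality using (euclidsLemma; prime?)
open import Data.Nat.Tactic.RingSolver using (solve-∀)
open import Data.Product using (_×_; _,_)
open import Data.Product.Properties using (≡-dec)
open import Data.Sum using (inj₁; inj₂)
open import Relation.Nullary using (Dec; contradiction)
open import Relation.Nullary.Decidable using (map′; _×-dec_; _→-dec_; from-yes; from-no)
open import Relation.Binary.PropositionalEquality using (refl; sym; trans; cong; cong₂; subst; module ≡-Reasoning)

open ≡-Reasoning

-- 𝔽₄ = 𝔽₂[ω]/(ω² + ω + 1); the pair (a , b) stands for a + bω.
𝔽₄ : Set
𝔽₄ = Bool × Bool

pattern 0# = false , false
pattern 1# = true , false
pattern ω  = false , true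
pattern ω² = true , true

infixl 6 _⊕_
infixl 7 _⊗_
infixr 8 _^𝔽_
infix 4 _≟_

_⊕_ : 𝔽₄ → 𝔽₄ → 𝔽₄
(a , b) ⊕ (c , d) = a xor c , b xor d

-- (a + bω)(c + dω) = (ac + bd) + (ad + bc + bd)ω, since ω² = 1 + ω
_⊗_ : 𝔽₄ → 𝔽₄ → 𝔽₄
(a , b) ⊗ (c , d) = (a ∧ c) xor (b ∧ d) , ((a ∧ d) xor (b ∧ c)) xor (b ∧ d)

_^𝔽_ : 𝔽₄ → ℕ → 𝔽₄
z ^𝔽 zero  = 1#
z ^𝔽 suc n = z ⊗ z ^𝔽 n

ι : Bool → 𝔽₄
ι a = a , false

_≟_ : (x y : 𝔽₄) → Dec (x ≡ y)
_≟_ = ≡-dec _≟ᵇ_ _≟ᵇ_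

-- A pointwise decidable property holds on all of 𝔽₄ decidably: check the
-- four elements.  Every identity of 𝔽₄ used below is verified this way.
∀? : {P : 𝔽₄ → Set} → ((x : 𝔽₄) → Dec (P x)) → Dec ((x : 𝔽₄) → P x)
∀? {P} P? = map′ every (λ h → h 0# , h 1# , h ω , h ω²)
                  (P? 0# ×-dec P? 1# ×-dec P? ω ×-dec P? ω²)
  where
    every : P 0# × P 1# × P ω × P ω² → (x : 𝔽₄) → P x
    every (p , _ , _ , _) 0# = p
    every (_ , p , _ , _) 1# = p
    every (_ , _ , p , _) ω  = p
    every (_ , _ , _ , p) ω² = p

⊕-comm : ∀ x y → x ⊕ y ≡ y ⊕ x
⊕-comm = from-yes (∀? λ x → ∀? λ y → x ⊕ y ≟ y ⊕ x)

⊕-assoc : ∀ x y z → x ⊕ y ⊕ z ≡ x ⊕ (y ⊕ z)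
⊕-assoc = from-yes (∀? λ x → ∀? λ y → ∀? λ z → x ⊕ y ⊕ z ≟ x ⊕ (y ⊕ z))

⊕-identityʳ : ∀ x → x ⊕ 0# ≡ x
⊕-identityʳ = from-yes (∀? λ x → x ⊕ 0# ≟ x)

⊕-interchange : ∀ x y u v → (x ⊕ y) ⊕ (u ⊕ v) ≡ (x ⊕ u) ⊕ (y ⊕ v)
⊕-interchange = from-yes (∀? λ x → ∀? λ y → ∀? λ u → ∀? λ v →
  (x ⊕ y) ⊕ (u ⊕ v) ≟ (x ⊕ u) ⊕ (y ⊕ v))

⊗-comm : ∀ x y → x ⊗ y ≡ y ⊗ x
⊗-comm = from-yes (∀? λ x → ∀? λ y → x ⊗ y ≟ y ⊗ x)

⊗-assoc : ∀ x y z → x ⊗ y ⊗ z ≡ x ⊗ (y ⊗ z)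
⊗-assoc = from-yes (∀? λ x → ∀? λ y → ∀? λ z → x ⊗ y ⊗ z ≟ x ⊗ (y ⊗ z))

⊗-identityˡ : ∀ x → 1# ⊗ x ≡ x
⊗-identityˡ = from-yes (∀? λ x → 1# ⊗ x ≟ x)

⊗-identityʳ : ∀ x → x ⊗ 1# ≡ x
⊗-identityʳ = from-yes (∀? λ x → x ⊗ 1# ≟ x)

⊗-zeroʳ : ∀ x → x ⊗ 0# ≡ 0#
⊗-zeroʳ = from-yes (∀? λ x → x ⊗ 0# ≟ 0#)

⊗-distribˡ : ∀ x y z → x ⊗ (y ⊕ z) ≡ x ⊗ y ⊕ x ⊗ z
⊗-distribˡ = from-yes (∀? λ x → ∀? λ y → ∀? λ z → x ⊗ (y ⊕ z) ≟ x ⊗ y ⊕ x ⊗ z)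

⊗-distribʳ : ∀ x y z → (y ⊕ z) ⊗ x ≡ y ⊗ x ⊕ z ⊗ x
⊗-distribʳ = from-yes (∀? λ x → ∀? λ y → ∀? λ z → (y ⊕ z) ⊗ x ≟ y ⊗ x ⊕ z ⊗ x)

⊗-cancel-unit : ∀ z z' x y → z ⊗ z' ≡ 1# → x ⊗ z ≡ y ⊗ z → x ≡ y
⊗-cancel-unit = from-yes (∀? λ z → ∀? λ z' → ∀? λ x → ∀? λ y →
  (z ⊗ z' ≟ 1#) →-dec (x ⊗ z ≟ y ⊗ z) →-dec (x ≟ y))

⊗-inverse-cancel : ∀ z z' x y → z ⊗ z' ≡ 1# → (z ⊗ x) ⊗ (z' ⊗ y) ≡ x ⊗ y
⊗-inverse-cancel = from-yes (∀? λ z → ∀? λ z' → ∀? λ x → ∀? λ y →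
  (z ⊗ z' ≟ 1#) →-dec ((z ⊗ x) ⊗ (z' ⊗ y) ≟ x ⊗ y))

ω³-cancel : ∀ x → ω ⊗ (ω ⊗ (ω ⊗ x)) ≡ x
ω³-cancel = from-yes (∀? λ x → ω ⊗ (ω ⊗ (ω ⊗ x)) ≟ x)

-- ω^N = 1 forces 3 ∣ N, since ω ≠ 1, ω² ≠ 1 and ω³ = 1
ω-order : ∀ N → ω ^𝔽 N ≡ 1# → 3 ∣ N
ω-order zero _ = 3 ∣0
ω-order (suc zero) ()
ω-order (suc (suc zero)) ()
ω-order (suc (suc (suc m))) ω³⁺ᵐ≡1 =
  ∣m∣n⇒∣m+n ∣-refl (ω-order m (trans (sym (ω³-cancel (ω ^𝔽 m))) ω³⁺ᵐ≡1))

eval : 𝔽₄ → Poly → 𝔽₄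
eval z []      = 0#
eval z (a ∷ p) = ι a ⊕ z ⊗ eval z p

eval-constant : ∀ z a → eval z (a ∷ []) ≡ ι a
eval-constant z a = trans (cong (ι a ⊕_) (⊗-zeroʳ z)) (⊕-identityʳ (ι a))

eval-+ : ∀ z p q → eval z (p +ₚ q) ≡ eval z p ⊕ eval z q
eval-+ z []      q       = refl
eval-+ z (a ∷ p) []      = sym (⊕-identityʳ _)
eval-+ z (a ∷ p) (b ∷ q) = begin
  ι (a xor b) ⊕ z ⊗ eval z (p +ₚ q)           ≡⟨ cong (λ t → ι (a xor b) ⊕ z ⊗ t) (eval-+ z p q) ⟩
  (ι a ⊕ ι b) ⊕ z ⊗ (eval z p ⊕ eval z q)     ≡⟨ cong (ι a ⊕ ι b ⊕_) (⊗-distribˡ z _ _) ⟩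
  (ι a ⊕ ι b) ⊕ (z ⊗ eval z p ⊕ z ⊗ eval z q) ≡⟨ ⊕-interchange (ι a) (ι b) (z ⊗ eval z p) (z ⊗ eval z q) ⟩
  (ι a ⊕ z ⊗ eval z p) ⊕ (ι b ⊕ z ⊗ eval z q) ∎

eval-* : ∀ z p q → eval z (p *ₚ q) ≡ eval z p ⊗ eval z q
eval-* z []      q = refl
eval-* z (a ∷ p) q = begin
  eval z ((if a then q else []) +ₚ (false ∷ p *ₚ q))  ≡⟨ eval-+ z (if a then q else []) _ ⟩
  eval z (if a then q else []) ⊕ z ⊗ eval z (p *ₚ q)  ≡⟨ cong₂ (λ s t → s ⊕ z ⊗ t) (eval-scale a) (eval-* z p q) ⟩
  ι a ⊗ eval z q ⊕ z ⊗ (eval z p ⊗ eval z q)          ≡⟨ cong (ι a ⊗ eval z q ⊕_) (sym (⊗-assoc z _ _)) ⟩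
  ι a ⊗ eval z q ⊕ z ⊗ eval z p ⊗ eval z q            ≡⟨ sym (⊗-distribʳ (eval z q) (ι a) _) ⟩
  (ι a ⊕ z ⊗ eval z p) ⊗ eval z q                     ∎
  where
    eval-scale : ∀ a → eval z (if a then q else []) ≡ ι a ⊗ eval z q
    eval-scale true  = sym (⊗-identityˡ (eval z q))
    eval-scale false = refl

IsZero : Poly → Set
IsZero p = p ≈ₚ []

eval-zero : ∀ z p → IsZero p → eval z p ≡ 0#
eval-zero z []      _ = refl
eval-zero z (a ∷ p) p≈0 with p≈0 0
... | refl = trans (cong (z ⊗_) (eval-zero z p (λ k → p≈0 (suc k)))) (⊗-zeroʳ z)

eval-resp : ∀ z p q → p ≈ₚ q → eval z p ≡ eval z q
eval-resp z []      q       p≈q = sym (eval-zero z q (λ k → sym (p≈q k)))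
eval-resp z (a ∷ p) []      p≈q = eval-zero z (a ∷ p) p≈q
eval-resp z (a ∷ p) (b ∷ q) p≈q =
  cong₂ (λ c e → ι c ⊕ z ⊗ e) (p≈q 0) (eval-resp z p q (λ k → p≈q (suc k)))

coeff-normalize : ∀ p → normalize p ≈ₚ p
coeff-normalize []      k = refl
coeff-normalize (a ∷ p) k with normalize p | coeff-normalize p
coeff-normalize (true  ∷ p) zero    | []    | _  = refl
coeff-normalize (false ∷ p) zero    | []    | _  = refl
coeff-normalize (true  ∷ p) (suc k) | []    | ih = ih k
coeff-normalize (false ∷ p) (suc k) | []    | ih = ih k
coeff-normalize (a ∷ p)     zero    | _ ∷ _ | _  = refl
coeff-normalize (a ∷ p)     (suc k) | _ ∷ _ | ih = ih k

eval-++ : ∀ z l m → eval z (l ++ m) ≡ eval z l ⊕ z ^𝔽 length l ⊗ eval z m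
eval-++ z []      m = sym (⊗-identityˡ (eval z m))
eval-++ z (x ∷ l) m = begin
  ι x ⊕ z ⊗ eval z (l ++ m)                           ≡⟨ cong (λ t → ι x ⊕ z ⊗ t) (eval-++ z l m) ⟩
  ι x ⊕ z ⊗ (eval z l ⊕ z ^𝔽 length l ⊗ eval z m)     ≡⟨ cong (ι x ⊕_) (⊗-distribˡ z _ _) ⟩
  ι x ⊕ (z ⊗ eval z l ⊕ z ⊗ (z ^𝔽 length l ⊗ eval z m)) ≡⟨ sym (⊕-assoc (ι x) (z ⊗ eval z l) _) ⟩
  ι x ⊕ z ⊗ eval z l ⊕ z ⊗ (z ^𝔽 length l ⊗ eval z m)   ≡⟨ cong (ι x ⊕ z ⊗ eval z l ⊕_) (sym (⊗-assoc z _ _)) ⟩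
  ι x ⊕ z ⊗ eval z l ⊕ z ⊗ z ^𝔽 length l ⊗ eval z m     ∎

eval-reverse : ∀ {z z'} → z ⊗ z' ≡ 1# → ∀ q →
  eval z (reverse q) ⊗ z ≡ z ^𝔽 length q ⊗ eval z' q
eval-reverse             zz'≡1 []      = refl
eval-reverse {z} {z'} zz'≡1 (x ∷ q) = begin
  eval z (reverse (x ∷ q)) ⊗ z                        ≡⟨ cong (λ r → eval z r ⊗ z) (unfold-reverse x q) ⟩
  eval z (reverse q ++ x ∷ []) ⊗ z                    ≡⟨ cong (_⊗ z) (eval-++ z (reverse q) (x ∷ [])) ⟩
  (R ⊕ z ^𝔽 length (reverse q) ⊗ eval z (x ∷ [])) ⊗ z ≡⟨ cong₂ (λ n e → (R ⊕ z ^𝔽 n ⊗ e) ⊗ z) (length-reverse q) (eval-constant z x) ⟩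
  (R ⊕ Z ⊗ ι x) ⊗ z                                   ≡⟨ ⊗-distribʳ z R _ ⟩
  R ⊗ z ⊕ Z ⊗ ι x ⊗ z                                 ≡⟨ cong₂ _⊕_ (eval-reverse zz'≡1 q) (rotate Z (ι x)) ⟩
  Z ⊗ E ⊕ z ⊗ Z ⊗ ι x                                 ≡⟨ ⊕-comm (Z ⊗ E) (z ⊗ Z ⊗ ι x) ⟩
  z ⊗ Z ⊗ ι x ⊕ Z ⊗ E                                 ≡⟨ cong (z ⊗ Z ⊗ ι x ⊕_) (sym (⊗-inverse-cancel z z' Z E zz'≡1)) ⟩
  z ⊗ Z ⊗ ι x ⊕ z ⊗ Z ⊗ (z' ⊗ E)                      ≡⟨ sym (⊗-distribˡ (z ⊗ Z) _ _) ⟩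
  z ⊗ Z ⊗ (ι x ⊕ z' ⊗ E)                              ∎
  where
    R Z E : 𝔽₄
    R = eval z (reverse q)
    Z = z ^𝔽 length q
    E = eval z' q
    rotate : ∀ s t → s ⊗ t ⊗ z ≡ z ⊗ s ⊗ t
    rotate s t = trans (⊗-comm (s ⊗ t) z) (sym (⊗-assoc z s t))

record HasDegree (p : Poly) (k : ℕ) : Set where
  constructor degree
  field
    leading   : coeff p k ≡ true
    vanishing : ∀ j → k < j → coeff p j ≡ false
open HasDegree

HasDegree-agree : ∀ {r s d} → (∀ j → d ≤ j → coeff r j ≡ coeff s j) →
  HasDegree s d → HasDegree r d
HasDegree-agree {d = d} agree (degree lead above) =
  degree (trans (agree d ≤-refl) lead) λ j d<j → trans (agree j (<⇒≤ d<j)) (above j d<j)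

HasDegree-∷ : ∀ {a p m} → HasDegree p m → HasDegree (a ∷ p) (suc m)
HasDegree-∷ (degree lead above) = degree lead λ { (suc j) (s≤s m<j) → above j m<j }

HasDegree-tail : ∀ {a p m} → HasDegree (a ∷ p) (suc m) → HasDegree p m
HasDegree-tail (degree lead above) = degree lead λ j m<j → above (suc j) (s≤s m<j)

coeff-+ : ∀ p q k → coeff (p +ₚ q) k ≡ coeff p k xor coeff q k
coeff-+ []      q       k       = refl
coeff-+ (a ∷ p) []      k       = sym (xor-identityʳ _)
coeff-+ (a ∷ p) (b ∷ q) zero    = refl
coeff-+ (a ∷ p) (b ∷ q) (suc k) = coeff-+ p q k

coeff-*-∷ : ∀ a p q k → coeff ((a ∷ p) *ₚ q) k ≡ (a ∧ coeff q k) xor coeff (false ∷ p *ₚ q) k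
coeff-*-∷ a p q k = trans (coeff-+ (if a then q else []) _ k) (cong (_xor _) (coeff-scale a))
  where
    coeff-scale : ∀ a → coeff (if a then q else []) k ≡ a ∧ coeff q k
    coeff-scale true  = refl
    coeff-scale false = refl

zero-* : ∀ p q → IsZero p → IsZero (p *ₚ q)
zero-* []      q _   k = refl
zero-* (a ∷ p) q p≈0 k with p≈0 0
zero-* (a ∷ p) q p≈0 zero    | refl = refl
zero-* (a ∷ p) q p≈0 (suc k) | refl = zero-* p q (λ j → p≈0 (suc j)) k

degree-* : ∀ p q {m k} → HasDegree p m → HasDegree q k → HasDegree (p *ₚ q) (m + k)
degree-* []      q {zero}  (degree () _) _
degree-* []      q {suc m} (degree () _) _
degree-* (a ∷ p) q {zero}  (degree refl above) hq = HasDegree-agree (λ j _ → unit-coeff j) hq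
  where
    unit-coeff : ∀ j → coeff ((true ∷ p) *ₚ q) j ≡ coeff q j
    unit-coeff j = trans (coeff-+ q (false ∷ p *ₚ q) j)
      (trans (cong (coeff q j xor_) (zero-* (false ∷ p) q (λ { zero → refl ; (suc i) → above (suc i) (s≤s z≤n) }) j))
             (xor-identityʳ (coeff q j)))
degree-* (a ∷ p) q {suc m} {k} hp hq =
  HasDegree-agree high-coeff (HasDegree-∷ (degree-* p q (HasDegree-tail hp) hq))
  where
    -- above deg q, the term a q does not contribute
    high-coeff : ∀ j → suc m + k ≤ j → coeff ((a ∷ p) *ₚ q) j ≡ coeff (false ∷ p *ₚ q) j
    high-coeff j bound = trans (coeff-*-∷ a p q j)
      (cong (_xor _) (trans (cong (a ∧_) (vanishing hq j (≤-trans (s≤s (m≤n+m k m)) bound))) (∧-zeroʳ a)))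

degree-^ : ∀ p {k} n → HasDegree p k → HasDegree (p ^ₚ n) (n * k)
degree-^ p zero    _  = degree refl λ { (suc j) _ → refl }
degree-^ p (suc n) hp = degree-* p (p ^ₚ n) hp (degree-^ p n hp)

degree-1+ : ∀ q {k} → 1 ≤ k → HasDegree q k → HasDegree (oneₚ +ₚ q) k
degree-1+ q {suc k} _ = HasDegree-agree λ { (suc j) _ → coeff-1+ q j }
  where
    coeff-1+ : ∀ q j → coeff (oneₚ +ₚ q) (suc j) ≡ coeff q (suc j)
    coeff-1+ []      j = refl
    coeff-1+ (_ ∷ _) j = refl

degree-X : HasDegree X 1
degree-X = degree refl λ { (suc zero) (s≤s ()) ; (suc (suc j)) _ → refl }

degree-X+1 : HasDegree X+1 1
degree-X+1 = degree refl λ { (suc zero) (s≤s ()) ; (suc (suc j)) _ → refl }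

degree-Q : HasDegree Qₚ 2
degree-Q = degree refl λ { (suc zero) (s≤s ()) ; (suc (suc zero)) (s≤s (s≤s ())) ; (suc (suc (suc j))) _ → refl }

degree-Qabc : ∀ a b c → 1 ≤ c → HasDegree (Qabc a b c) (a + b + 2 * c)
degree-Qabc a b c 1≤c = degree-1+ _ 1≤N (subst (HasDegree _) (N-eq a b c)
  (degree-* (X ^ₚ a) _ (degree-^ X a degree-X)
    (degree-* (X+1 ^ₚ b) _ (degree-^ X+1 b degree-X+1) (degree-^ Qₚ c degree-Q))))
  where
    N-eq : ∀ a b c → a * 1 + (b * 1 + c * 2) ≡ a + b + 2 * c
    N-eq = solve-∀
    1≤N : 1 ≤ a + b + 2 * c
    1≤N = ≤-trans 1≤c (≤-trans (m≤n*m c 2) (m≤n+m (2 * c) (a + b)))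

normalize-zero : ∀ p → IsZero p → normalize p ≡ []
normalize-zero []      _   = refl
normalize-zero (a ∷ p) p≈0 with normalize p | normalize-zero p (λ k → p≈0 (suc k)) | p≈0 0
... | [] | refl | refl = refl

length-normalize : ∀ p {k} → HasDegree p k → length (normalize p) ≡ suc k
length-normalize [] (degree () _)
length-normalize (a ∷ p) {zero} (degree lead above)
  with normalize p | normalize-zero p (λ j → above (suc j) (s≤s z≤n)) | lead
... | [] | refl | refl = refl
length-normalize (a ∷ p) {suc k} hp with normalize p | length-normalize p (HasDegree-tail hp)
... | []    | ()
... | _ ∷ _ | len = cong suc len

eval-reciprocal : ∀ {z z'} → z ⊗ z' ≡ 1# → ∀ p {N} → HasDegree p N →
  eval z (reciprocal p) ≡ z ^𝔽 N ⊗ eval z' p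
eval-reciprocal {z} {z'} zz'≡1 p {N} hp = ⊗-cancel-unit z z' _ _ zz'≡1 (begin
  eval z (reverse (normalize p)) ⊗ z              ≡⟨ eval-reverse zz'≡1 (normalize p) ⟩
  z ^𝔽 length (normalize p) ⊗ eval z' (normalize p) ≡⟨ cong₂ (λ n e → z ^𝔽 n ⊗ e) (length-normalize p hp) (eval-resp z' (normalize p) p (coeff-normalize p)) ⟩
  z ⊗ z ^𝔽 N ⊗ eval z' p                          ≡⟨ trans (cong (_⊗ eval z' p) (⊗-comm z (z ^𝔽 N))) (⊗-assoc (z ^𝔽 N) z _) ⟩
  z ^𝔽 N ⊗ (z ⊗ eval z' p)                        ≡⟨ cong (z ^𝔽 N ⊗_) (⊗-comm z _) ⟩
  z ^𝔽 N ⊗ (eval z' p ⊗ z)                        ≡⟨ sym (⊗-assoc (z ^𝔽 N) (eval z' p) z) ⟩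
  z ^𝔽 N ⊗ eval z' p ⊗ z                          ∎)

-- Q divides Q^{abc} - 1, so Q^{abc} is 1 at every root of Q
Qabc-at-root : ∀ {z} → eval z Qₚ ≡ 0# → ∀ a b c → 1 ≤ c → eval z (Qabc a b c) ≡ 1#
Qabc-at-root {z} Q[z]≡0 a b (suc c) _ = begin
  eval z (oneₚ +ₚ X ^ₚ a *ₚ (X+1 ^ₚ b *ₚ Qₚ ^ₚ suc c))
    ≡⟨ eval-+ z oneₚ (X ^ₚ a *ₚ (X+1 ^ₚ b *ₚ Qₚ ^ₚ suc c)) ⟩
  eval z oneₚ ⊕ eval z (X ^ₚ a *ₚ (X+1 ^ₚ b *ₚ Qₚ ^ₚ suc c))
    ≡⟨ cong₂ _⊕_ (eval-constant z true) (trans (eval-* z (X ^ₚ a) _) (cong (eval z (X ^ₚ a) ⊗_) (eval-* z (X+1 ^ₚ b) _))) ⟩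
  1# ⊕ eval z (X ^ₚ a) ⊗ (eval z (X+1 ^ₚ b) ⊗ eval z (Qₚ ^ₚ suc c))
    ≡⟨ cong (λ t → 1# ⊕ eval z (X ^ₚ a) ⊗ (eval z (X+1 ^ₚ b) ⊗ t)) Qᶜ⁺¹[z]≡0 ⟩
  1# ⊕ eval z (X ^ₚ a) ⊗ (eval z (X+1 ^ₚ b) ⊗ 0#)
    ≡⟨ cong (λ t → 1# ⊕ eval z (X ^ₚ a) ⊗ t) (⊗-zeroʳ (eval z (X+1 ^ₚ b))) ⟩
  1# ⊕ eval z (X ^ₚ a) ⊗ 0#
    ≡⟨ cong (1# ⊕_) (⊗-zeroʳ (eval z (X ^ₚ a))) ⟩
  1# ∎
  where
    Qᶜ⁺¹[z]≡0 : eval z (Qₚ ^ₚ suc c) ≡ 0#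
    Qᶜ⁺¹[z]≡0 = trans (eval-* z Qₚ (Qₚ ^ₚ c)) (cong (_⊗ eval z (Qₚ ^ₚ c)) Q[z]≡0)

-- 3 is prime and does not divide 2
3∣2ⁿu⇒3∣u : ∀ n u → 3 ∣ 2 ^ n * u → 3 ∣ u
3∣2ⁿu⇒3∣u zero    u 3∣u    = subst (3 ∣_) (*-identityˡ u) 3∣u
3∣2ⁿu⇒3∣u (suc n) u 3∣2ⁿ⁺¹u
  with euclidsLemma 2 (2 ^ n * u) (from-yes (prime? 3)) (subst (3 ∣_) (*-assoc 2 (2 ^ n) u) 3∣2ⁿ⁺¹u)
... | inj₁ 3∣2   = contradiction 3∣2 (from-no (3 ∣? 2))
... | inj₂ 3∣2ⁿu = 3∣2ⁿu⇒3∣u n u 3∣2ⁿu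

lemma3p16 : (a b c d e f n u : ℕ) →
    1 ≤ a → 1 ≤ b → 1 ≤ c → 1 ≤ d → 1 ≤ e → 1 ≤ f →
    Irreducible (Qabc a b c) →
    reciprocal (Qabc a b c) ≈ₚ Qabc d e f →
    ¬ (Qabc d e f ≈ₚ Qabc a b c) →
    a + b + 2 * c ≡ 2 ^ n * u →
    ¬ (2 ∣ u) →
    3 ∣ u
lemma3p16 a b c d e f n u _ _ 1≤c _ _ 1≤f _ P*≈Qdef _ N≡2ⁿu _ =
  3∣2ⁿu⇒3∣u n u (subst (3 ∣_) N≡2ⁿu (ω-order N ωᴺ≡1))
  where
    P : Poly
    P = Qabc a b c
    N : ℕ
    N = a + b + 2 * c
    ωᴺ≡1 : ω ^𝔽 N ≡ 1#
    ωᴺ≡1 = begin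
      ω ^𝔽 N                ≡⟨ sym (⊗-identityʳ _) ⟩
      ω ^𝔽 N ⊗ 1#           ≡⟨ cong (ω ^𝔽 N ⊗_) (sym (Qabc-at-root refl a b c 1≤c)) ⟩
      ω ^𝔽 N ⊗ eval ω² P    ≡⟨ sym (eval-reciprocal refl P (degree-Qabc a b c 1≤c)) ⟩
      eval ω (reciprocal P) ≡⟨ eval-resp ω (reciprocal P) (Qabc d e f) P*≈Qdef ⟩
      eval ω (Qabc d e f)   ≡⟨ Qabc-at-root refl d e f 1≤f ⟩
      1#                    ∎
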